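{- Let $\mathbf{O}$ be an appropriate class of continuous operators such that the functions $\check{c}$ for all $c\in\mathbb{N}$ and the functions $\mu_{k,c}$ for all $k,c\in\mathbb{N}$ are $\mathbf{O}$-representable. Then every conditionally $\mathbf{O}$-computable real function is locally uniformly $\mathbf{O}$-computable.
   Context: For $m\in\mathbb{N}$, $\mathbb{T}_m$ is the set of all total functions $\mathbb{N}^m\to\mathbb{N}$. For $k\in\mathbb{N}$, a $k$-ary operator is a mapping $\mathbb{T}_1^k\to\mathbb{T}_1$. For $c\in\mathbb{N}$, $\check{c}\in\mathbb{T}_1$ is the constant function with value $c$. An operator $F:\mathbb{T}_1^k\to\mathbb{T}_1$ is continuous if for all $f_1,\ldots,f_k\in\mathbb{T}_1$ and $n\in\mathbb{N}$ there is $u\in\mathbb{N}$ such that $F(g_1,\ldots,g_k)(n)=F(f_1,\ldots,f_k)(n)$ whenever $g_1,\ldots,g_k\in\mathbb{T}_1$ agree with $f_1,\ldots,f_k$ respectively on all $t\le u$. A class $\mathbf{O}$ of operators is appropriate if: (1) for all $k$ and $i\in\{1,\ldots,k\}$ the operator $(f_1,\ldots,f_k)\mapsto f_i$ is in $\mathbf{O}$; (2) the operator $F(f_1,f_2)(n)=f_1(f_2(n))$ is in $\mathbf{O}$; (3) if $F$ is a $k$-ary operator in $\mathbf{O}$ and $G_1,\ldots,G_k$ are $l$-ary operators in $\mathbf{O}$, then $H(g_1,\ldots,g_l)=F(G_1(g_1,\ldots,g_l),\ldots,G_k(g_1,\ldots,g_l))$ is in $\mathbf{O}$; (4) if $F$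 is a $(k+1)$-ary operator in $\mathbf{O}$, then $G(f_1,\ldots,f_k)(n)=F(f_1,\ldots,f_k,\check{n})(n)$ is in $\mathbf{O}$. For $f:\mathbb{N}^k\to\mathbb{N}$, $\mathring{f}(f_1,\ldots,f_k)(n)=f(f_1(n),\ldots,f_k(n))$; $f$ is $\mathbf{O}$-representable if $\mathring{f}\in\mathbf{O}$. For $k,c\in\mathbb{N}$, $\mu_{k,c}:\mathbb{N}^2\to\mathbb{N}$ is $\mu_{k,c}(x,y)=c$ if $x=k$ and $y$ otherwise. A triple $(f,g,h)\in\mathbb{T}_1^3$ names $\xi\in\mathbb{R}$ if $\left|\frac{f(t)-g(t)}{h(t)+1}-\xi\right|<\frac{1}{t+1}$ for all $t$. A real function is any $\theta:D\to\mathbb{R}$ with $D\subseteq\mathbb{R}^N$ for some $N$. Such $\theta$ is uniformly $\mathbf{O}$-computable if there are $3N$-ary $F,G,H\in\mathbf{O}$ such that whenever $(\xi_1,\ldots,\xi_N)\in D$ and $(f_j,g_j,h_j)$ names $\xi_j$ ($j=1,\ldots,N$), the triple $(F(\bar f),G(\bar f),H(\bar f))$, with $\bar f=(f_1,g_1,h_1,\ldots,f_N,g_N,h_N)$, names $\theta(\xi_1,\ldots,\xi_N)$. It is conditionally $\mathbf{O}$-computable if there exist a $3N$-ary $E$ and $(3N+1)$-ary $F,G,H$, all in $\mathbf{O}$, such that whenever $(\xi_1,\ldots,\xi_N)\in D$ and $(f_j,g_j,h_j)$ names $\xi_j$: there is $s$ with $E(\bar f)(s)=0$, and for every such $s$ the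 triple $(F(\bar f,\check s),G(\bar f,\check s),H(\bar f,\check s))$ names $\theta(\xi_1,\ldots,\xi_N)$. It is locally uniformly $\mathbf{O}$-computable if every point of $D$ has a neighbourhood $U$ such that the restriction of $\theta$ to $D\cap U$ is uniformly $\mathbf{O}$-computable. -}

module Defs where

open import Data.Nat as ℕ using (ℕ; zero; suc)
open import Data.Fin using (Fin; zero; suc)
open import Data.Integer using (ℤ; +_)
import Data.Integer as ℤ
open import Data.Rational using (ℚ; _+_; _-_; _<_; _≤_; ∣_∣; _/_; 0ℚ)
open import Data.Product using (Σ; _×_)
open import Relation.Binary.PropositionalEquality using (_≡_)
open import Relation.Nullary using (yes; no)
import Data.Product

𝕋₁ : Set
𝕋₁ = ℕ → ℕ

Op : ℕ → Set
Op k = (Fin k → 𝕋₁) → 𝕋₁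

ǩ : ℕ → 𝕋₁
ǩ c _ = c

snoc : ∀ {k} → (Fin k → 𝕋₁) → 𝕋₁ → Fin (suc k) → 𝕋₁
snoc {zero}  fs g zero    = g
snoc {suc k} fs g zero    = fs zero
snoc {suc k} fs g (suc i) = snoc (λ j → fs (suc j)) g i

OpClass : Set₁
OpClass = ∀ {k} → Op k → Set

Continuous : ∀ {k} → Op k → Set
Continuous {k} F =
  (fs : Fin k → 𝕋₁) (n : ℕ) → Σ ℕ λ u →
    (gs : Fin k → 𝕋₁) → (∀ i t → t ℕ.≤ u → gs i t ≡ fs i t) →
    F gs n ≡ F fs n

record Appropriate (O : OpClass) : Set where
  field
    proj : ∀ k (i : Fin k) → O {k} (λ fs → fs i)
    comp : O {2} (λ fs n → fs zero (fs (suc zero) n))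
    subst-op : ∀ k l (F : Op k) (Gs : Fin k → Op l) → O F → (∀ i → O (Gs i)) →
           O {l} (λ gs → F (λ i → Gs i gs))
    diag : ∀ k (F : Op (suc k)) → O F → O {k} (λ fs n → F (snoc fs (ǩ n)) n)

ring : ∀ {k} → ((Fin k → ℕ) → ℕ) → Op k
ring f fs n = f (λ i → fs i n)

Representable : OpClass → ∀ {k} → ((Fin k → ℕ) → ℕ) → Set
Representable O f = O (ring f)

μ : ℕ → ℕ → ℕ → ℕ → ℕ
μ k c x y with x ℕ.≟ k
... | yes _ = c
... | no  _ = y

-- Real numbers (Bishop's regular Cauchy sequences of rationals)

1/suc : ℕ → ℚ
1/suc n = + 1 / suc n

record ℝ : Set where
  field
    seq : ℕ → ℚ
    reg : ∀ m n → ∣ seq m - seq n ∣ ≤ 1/suc m + 1/suc n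
open ℝ public

-- |q - ξ| < ε  for q rational, ξ real
DistQℝ< : ℚ → ℝ → ℚ → Set
DistQℝ< q ξ ε = Σ ℕ λ n → ∣ q - seq ξ n ∣ + 1/suc n < ε

-- |ξ - η| < ε  for reals ξ, η  (ξ - η has the regular sequence n ↦ ξ(2n+1) - η(2n+1))
Distℝ< : ℝ → ℝ → ℚ → Set
Distℝ< ξ η ε = Σ ℕ λ n →
  ∣ seq ξ (suc (2 ℕ.* n)) - seq η (suc (2 ℕ.* n)) ∣ + 1/suc n < ε

Names : 𝕋₁ → 𝕋₁ → 𝕋₁ → ℝ → Set
Names f g h ξ = ∀ t → DistQℝ< ((+ f t ℤ.- + g t) / suc (h t)) ξ (1/suc t)

interleave : ∀ N → (Fin N → 𝕋₁) → (Fin N → 𝕋₁) → (Fin N → 𝕋₁) → Fin (N ℕ.* 3) → 𝕋₁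
interleave (suc N) f g h zero                   = f zero
interleave (suc N) f g h (suc zero)             = g zero
interleave (suc N) f g h (suc (suc zero))       = h zero
interleave (suc N) f g h (suc (suc (suc i)))    =
  interleave N (λ j → f (suc j)) (λ j → g (suc j)) (λ j → h (suc j)) i

Point : ℕ → Set
Point N = Fin N → ℝ

Dom : ℕ → Set₁
Dom N = Point N → Set

RealFun : ∀ N → Dom N → Set
RealFun N D = (x : Point N) → D x → ℝ

UniformlyComputable : OpClass → ∀ N (D : Dom N) → RealFun N D → Set
UniformlyComputable O N D θ =
  Σ (Op (N ℕ.* 3)) λ F → Σ (Op (N ℕ.* 3)) λ G → Σ (Op (N ℕ.* 3)) λ H →
    O F × O G × O H ×
    ((x : Point N) (d : D x) (f g h : Fin N → 𝕋₁) →
      (∀ j → Names (f j) (g j) (h j) (x j)) →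
      let fb = interleave N f g h in
      Names (F fb) (G fb) (H fb) (θ x d))

ConditionallyComputable : OpClass → ∀ N (D : Dom N) → RealFun N D → Set
ConditionallyComputable O N D θ =
  Σ (Op (N ℕ.* 3)) λ E →
  Σ (Op (suc (N ℕ.* 3))) λ F → Σ (Op (suc (N ℕ.* 3))) λ G → Σ (Op (suc (N ℕ.* 3))) λ H →
    O E × O F × O G × O H ×
    ((x : Point N) (d : D x) (f g h : Fin N → 𝕋₁) →
      (∀ j → Names (f j) (g j) (h j) (x j)) →
      let fb = interleave N f g h in
      (Σ ℕ λ s → E fb s ≡ 0) ×
      (∀ s → E fb s ≡ 0 →
        Names (F (snoc fb (ǩ s))) (G (snoc fb (ǩ s))) (H (snoc fb (ǩ s))) (θ x d)))

Neighbourhood : ∀ N → (Point N → Set) → Point N → Set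
Neighbourhood N U x = Σ ℚ λ ε → (0ℚ < ε) ×
  ((y : Point N) → (∀ j → Distℝ< (y j) (x j) ε) → U y)

LocallyUniformlyComputable : OpClass → ∀ N (D : Dom N) → RealFun N D → Set₁
LocallyUniformlyComputable O N D θ =
  (x : Point N) → D x → Σ (Point N → Set) λ U → Neighbourhood N U x ×
    UniformlyComputable O N (λ y → D y × U y) (λ y dy → θ y (Data.Product.proj₁ dy))

module Submission where

-- Fix x ∈ D and its canonical name: the encoded rationals t ↦ x(2t+1).  The
-- conditional operator E vanishes at some s₀ on this name, and by continuity
-- of E this only depends on the name below some bound u.  On the ball of
-- radius 1/(2u+2) around x we may therefore replace the first u+1 values of
-- any name of a point y by those of the canonical name of x: the result still
-- names y (canonical-near) and E vanishes on it at s₀.  Feeding these patched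
-- names together with the constant s₀ into F, G, H gives the uniform operators.
-- Patching below a bound is realised inside O by iterating the
-- representable functions μ_{k,c} (patch), and s₀ by a representable constant.

open import Defs
open import Data.Nat as ℕ using (ℕ; zero; suc; _<_; _<?_; z≤n; s≤s)
import Data.Nat.Properties as ℕP
import Data.Nat.Coprimality as Coprimality
open import Data.Nat.Tactic.RingSolver using (solve-∀)
open import Data.Integer as ℤ using (+_; -[1+_])
import Data.Integer.Properties as ℤP
open import Data.Rational as ℚ using (ℚ; mkℚ; _+_; _-_; ∣_∣; _/_; 0ℚ)
import Data.Rational.Properties as ℚP
import Data.Rational.Unnormalised as ℚᵘ
import Data.Rational.Unnormalised.Properties as ℚᵘP
open import Data.Rational.Solver using (module +-*-Solver)
open import Data.Fin using (Fin; zero; suc)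
open import Data.Product using (_,_; proj₁; proj₂)
open import Relation.Nullary using (¬_; yes; no; contradiction)
open import Relation.Binary.Definitions using (Tri; tri<; tri≈; tri>)
open import Relation.Binary.PropositionalEquality
open +-*-Solver using (solve; _:+_; _:-_; :-_; _:=_)

1/suc-normal : ∀ k → 1/suc k ≡ mkℚ (+ 1) k (Coprimality.1-coprimeTo (suc k))
1/suc-normal k = ℚP.normalize-coprime (Coprimality.1-coprimeTo (suc k))

1/suc-pos : ∀ k → 0ℚ ℚ.< 1/suc k
1/suc-pos k rewrite 1/suc-normal k = ℚ.*<* (ℤ.+<+ (s≤s z≤n))

1/suc-antitone : ∀ {t u} → t ℕ.≤ u → 1/suc u ℚ.≤ 1/suc t
1/suc-antitone {t} {u} t≤u rewrite 1/suc-normal u | 1/suc-normal t =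
  ℚ.*≤* (ℤ.+≤+ (s≤s (ℕP.+-monoˡ-≤ 0 t≤u)))

-- 1/(2n+2) + 1/(2n+2) = 1/(n+1): the halving built into regular sequences.
1/suc-half : ∀ n → 1/suc (suc (2 ℕ.* n)) + 1/suc (suc (2 ℕ.* n)) ≡ 1/suc n
1/suc-half n = ℚP.toℚᵘ-injective (ℚᵘP.≃-trans
    (ℚP.toℚᵘ-homo-+ (1/suc k) (1/suc k))
    (subst₂ (λ a b → ℚ.toℚᵘ a ℚᵘ.+ ℚ.toℚᵘ a ℚᵘ.≃ ℚ.toℚᵘ b)
            (sym (1/suc-normal k)) (sym (1/suc-normal n))
            (ℚᵘ.*≡* (cong +_ (cross-multiplied n)))))
  where
  k = suc (2 ℕ.* n)
  -- (2n+2 + 2n+2)·(n+1) = (2n+2)², in the shape that cross-multiplication unfolds to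
  cross-multiplied : ∀ n → (1 ℕ.* (2 ℕ.+ 2 ℕ.* n) ℕ.+ 1 ℕ.* (2 ℕ.+ 2 ℕ.* n)) ℕ.* (1 ℕ.+ n)
                         ≡ 1 ℕ.* ((2 ℕ.+ 2 ℕ.* n) ℕ.* (2 ℕ.+ 2 ℕ.* n))
  cross-multiplied = solve-∀

canonical : ℝ → ℕ → ℚ
canonical ξ t = seq ξ (suc (2 ℕ.* t))

canonical-self : ∀ (ξ : ℝ) t → DistQℝ< (canonical ξ t) ξ (1/suc t)
canonical-self ξ t = m , (begin-strict
    ∣ q - q ∣ + 1/suc m   ≡⟨ cong (λ z → ∣ z ∣ + 1/suc m) (ℚP.+-inverseʳ q) ⟩
    0ℚ + 1/suc m          <⟨ ℚP.+-monoˡ-< (1/suc m) (1/suc-pos m) ⟩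
    1/suc m + 1/suc m     ≡⟨ 1/suc-half t ⟩
    1/suc t               ∎)
  where
  open ℚP.≤-Reasoning
  m = suc (2 ℕ.* t)
  q = seq ξ m

-- If η lies within 1/(2u+2) of ξ, then for t ≤ u the canonical approximation
-- of ξ at precision t is also a valid approximation of η (triangle inequality
-- through ξ(2n+1), where n witnesses the closeness).
canonical-near : ∀ (ξ η : ℝ) u t → t ℕ.≤ u →
  Distℝ< η ξ (1/suc (suc (2 ℕ.* u))) → DistQℝ< (canonical ξ t) η (1/suc t)
canonical-near ξ η u t t≤u (n , close) = k , (begin-strict
    ∣ q - ηk ∣ + r k
      ≡⟨ cong (λ z → ∣ z ∣ + r k) (via-ξk q ηk ξk) ⟩
    ∣ (q - ξk) + (ξk - ηk) ∣ + r k
      ≤⟨ ℚP.+-monoˡ-≤ (r k) (ℚP.∣p+q∣≤∣p∣+∣q∣ (q - ξk) (ξk - ηk)) ⟩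
    (∣ q - ξk ∣ + ∣ ξk - ηk ∣) + r k
      ≤⟨ ℚP.+-monoˡ-≤ (r k) (ℚP.+-mono-≤ (reg ξ m k) (ℚP.≤-reflexive (∣-∣-swap ξk ηk))) ⟩
    ((r m + r k) + ∣ ηk - ξk ∣) + r k
      ≡⟨ regroup (r m) (r k) ∣ ηk - ξk ∣ (r k) ⟩
    r m + (∣ ηk - ξk ∣ + (r k + r k))
      ≡⟨ cong (λ z → r m + (∣ ηk - ξk ∣ + z)) (1/suc-half n) ⟩
    r m + (∣ ηk - ξk ∣ + r n)
      <⟨ ℚP.+-monoʳ-< (r m) close ⟩
    r m + r (suc (2 ℕ.* u))
      ≤⟨ ℚP.+-monoʳ-≤ (r m) (1/suc-antitone (s≤s (ℕP.*-monoʳ-≤ 2 t≤u))) ⟩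
    r m + r m
      ≡⟨ 1/suc-half t ⟩
    r t ∎)
  where
  open ℚP.≤-Reasoning
  r = 1/suc
  k = suc (2 ℕ.* n)
  m = suc (2 ℕ.* t)
  q = seq ξ m
  ηk = seq η k
  ξk = seq ξ k
  via-ξk : ∀ a b c → a - b ≡ (a - c) + (c - b)
  via-ξk = solve 3 (λ a b c → a :- b := (a :- c) :+ (c :- b)) refl
  regroup : ∀ a b c d → ((a + b) + c) + d ≡ a + (c + (b + d))
  regroup = solve 4 (λ a b c d → ((a :+ b) :+ c) :+ d := a :+ (c :+ (b :+ d))) refl
  ∣-∣-swap : ∀ a b → ∣ a - b ∣ ≡ ∣ b - a ∣
  ∣-∣-swap a b = trans (cong ∣_∣ (solve 2 (λ a b → a :- b := :- (b :- a)) refl a b))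
                       (ℚP.∣-p∣≡∣p∣ (b - a))

enc⁺ enc⁻ encᵈ : ℚ → ℕ
enc⁺ (mkℚ (+ a) _ _)    = a
enc⁺ (mkℚ -[1+ _ ] _ _) = 0
enc⁻ (mkℚ (+ _) _ _)    = 0
enc⁻ (mkℚ -[1+ a ] _ _) = suc a
encᵈ p = ℚ.denominator-1 p

decode : ℕ → ℕ → ℕ → ℚ
decode a b c = (+ a ℤ.- + b) / suc c

decode-enc : ∀ p → decode (enc⁺ p) (enc⁻ p) (encᵈ p) ≡ p
decode-enc p@(mkℚ (+ a) d _) =
  trans (cong (λ z → z / suc d) (ℤP.+-identityʳ (+ a))) (ℚP.↥p/↧p≡p p)
decode-enc p@(mkℚ -[1+ _ ] _ _) = ℚP.↥p/↧p≡p p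

enc-close : ∀ p ξ ε → DistQℝ< p ξ ε → DistQℝ< (decode (enc⁺ p) (enc⁻ p) (encᵈ p)) ξ ε
enc-close p ξ ε = subst (λ q → DistQℝ< q ξ ε) (sym (decode-enc p))

names-cong : ∀ {f g h f′ g′ h′ ξ} →
  (∀ t → f t ≡ f′ t) → (∀ t → g t ≡ g′ t) → (∀ t → h t ≡ h′ t) →
  Names f g h ξ → Names f′ g′ h′ ξ
names-cong ef eg eh nm t rewrite sym (ef t) | sym (eg t) | sym (eh t) = nm t

canon⁺ canon⁻ canonᵈ : ℝ → 𝕋₁
canon⁺ ξ t = enc⁺ (canonical ξ t)
canon⁻ ξ t = enc⁻ (canonical ξ t)
canonᵈ ξ t = encᵈ (canonical ξ t)

canonical-names : ∀ ξ → Names (canon⁺ ξ) (canon⁻ ξ) (canonᵈ ξ) ξ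
canonical-names ξ t = enc-close (canonical ξ t) ξ (1/suc t) (canonical-self ξ t)

override : ℕ → 𝕋₁ → 𝕋₁ → 𝕋₁
override m c b n with n <? m
... | yes _ = c n
... | no  _ = b n

override-< : ∀ m {n} c b → n < m → override m c b n ≡ c n
override-< m {n} c b n<m with n <? m
... | yes _   = refl
... | no  n≮m = contradiction n<m n≮m

override-≮ : ∀ m {n} c b → ¬ n < m → override m c b n ≡ b n
override-≮ m {n} c b n≮m with n <? m
... | yes n<m = contradiction n<m n≮m
... | no  _   = refl

names-override : ∀ (ξ η : ℝ) u {f g h} → Names f g h η →
  Distℝ< η ξ (1/suc (suc (2 ℕ.* u))) →
  Names (override (suc u) (canon⁺ ξ) f) (override (suc u) (canon⁻ ξ) g)
        (override (suc u) (canonᵈ ξ) h) η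
names-override ξ η u nm close t with t <? suc u
... | yes t<1+u = enc-close (canonical ξ t) η (1/suc t) (canonical-near ξ η u t (ℕP.≤-pred t<1+u) close)
... | no  _     = nm t

interleave-pointwise : ∀ N (op : 𝕋₁ → 𝕋₁ → 𝕋₁) (f₀ g₀ h₀ f g h : Fin N → 𝕋₁) i →
  interleave N (λ j → op (f₀ j) (f j)) (λ j → op (g₀ j) (g j)) (λ j → op (h₀ j) (h j)) i
  ≡ op (interleave N f₀ g₀ h₀ i) (interleave N f g h i)
interleave-pointwise (suc N) op f₀ g₀ h₀ f g h zero             = refl
interleave-pointwise (suc N) op f₀ g₀ h₀ f g h (suc zero)       = refl
interleave-pointwise (suc N) op f₀ g₀ h₀ f g h (suc (suc zero)) = refl
interleave-pointwise (suc N) op f₀ g₀ h₀ f g h (suc (suc (suc i))) =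
  interleave-pointwise N op (λ j → f₀ (suc j)) (λ j → g₀ (suc j)) (λ j → h₀ (suc j))
                            (λ j → f (suc j)) (λ j → g (suc j)) (λ j → h (suc j)) i

μ-hit : ∀ k c y → μ k c k y ≡ c
μ-hit k c y with k ℕ.≟ k
... | yes _  = refl
... | no k≢k = contradiction refl k≢k

μ-miss : ∀ k c x y → x ≢ k → μ k c x y ≡ y
μ-miss k c x y x≢k with x ℕ.≟ k
... | yes x≡k = contradiction x≡k x≢k
... | no  _   = refl

setAt : ∀ {K} → ℕ → ℕ → Op K → Op K
setAt k c B fs n = μ k c n (B fs n)

patch : ∀ {K} → 𝕋₁ → ℕ → Op K → Op K
patch c zero    B = B
patch c (suc m) B = patch c m (setAt m (c m) B)

patch-override : ∀ {K} c m (B : Op K) fs n → patch c m B fs n ≡ override m c (B fs) n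
patch-override c zero B fs n = sym (override-≮ 0 c (B fs) (λ ()))
patch-override c (suc m) B fs n =
  trans (patch-override c m (setAt m (c m) B) fs n) (extend (ℕP.<-cmp n m))
  where
  extend : Tri (n < m) (n ≡ m) (m < n) → override m c (setAt m (c m) B fs) n ≡ override (suc m) c (B fs) n
  extend (tri< n<m _ _) = trans (override-< m c _ n<m) (sym (override-< (suc m) c _ (ℕP.m≤n⇒m≤1+n n<m)))
  extend (tri≈ _ refl _) = begin
    override n c (setAt n (c n) B fs) n ≡⟨ override-≮ n c _ (ℕP.<-irrefl refl) ⟩
    μ n (c n) n (B fs n)                ≡⟨ μ-hit n (c n) (B fs n) ⟩
    c n                                 ≡⟨ sym (override-< (suc n) c _ (ℕP.n<1+n n)) ⟩
    override (suc n) c (B fs) n         ∎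
    where open ≡-Reasoning
  extend (tri> _ _ m<n) = begin
    override m c (setAt m (c m) B fs) n ≡⟨ override-≮ m c _ (ℕP.<⇒≯ m<n) ⟩
    μ m (c m) n (B fs n)                ≡⟨ μ-miss m (c m) n (B fs n) (ℕP.>⇒≢ m<n) ⟩
    B fs n                              ≡⟨ sym (override-≮ (suc m) c _ (ℕP.<⇒≱ (s≤s m<n))) ⟩
    override (suc m) c (B fs) n         ∎
    where open ≡-Reasoning

snoc-pointwise : ∀ {k} (as bs : Fin k → 𝕋₁) g → (∀ i t → as i t ≡ bs i t) →
  ∀ i t → snoc as g i t ≡ snoc bs g i t
snoc-pointwise {zero}  as bs g eq zero    t = refl
snoc-pointwise {suc k} as bs g eq zero    t = eq zero t
snoc-pointwise {suc k} as bs g eq (suc i) t =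
  snoc-pointwise (λ j → as (suc j)) (λ j → bs (suc j)) g (λ j → eq (suc j)) i t

continuous-ext : ∀ {k} (F : Op k) → Continuous F → (fs gs : Fin k → 𝕋₁) →
  (∀ i t → gs i t ≡ fs i t) → ∀ n → F gs n ≡ F fs n
continuous-ext F cont fs gs eq n = proj₂ (cont fs n) gs (λ i t _ → eq i t)

freeze : ∀ {K} → (Fin K → 𝕋₁) → ℕ → ℕ → Op (suc K) → Op K
freeze c m s P fb = P (snoc (λ i → patch (c i) m (λ fs → fs i) fb) (ǩ s))

freeze-spec : ∀ {K} c m s (P : Op (suc K)) → Continuous P → (fb as : Fin K → 𝕋₁) →
  (∀ i t → as i t ≡ override m (c i) (fb i) t) →
  ∀ n → P (snoc as (ǩ s)) n ≡ freeze c m s P fb n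
freeze-spec c m s P cont fb as as≗ =
  continuous-ext P cont _ _
    (snoc-pointwise _ _ (ǩ s) (λ i t → trans (as≗ i t) (sym (patch-override (c i) m _ fb t))))

module Closure (O : OpClass) (A : Appropriate O)
  (constR : ∀ c → Representable O {1} (λ _ → c))
  (μR : ∀ k c → Representable O {2} (λ v → μ k c (v zero) (v (suc zero)))) where
  open Appropriate A

  weaken : ∀ K (P : Op 0) → O P → O {K} (λ _ → P (λ ()))
  weaken K P OP = subst-op 0 K P (λ ()) OP (λ ())

  constO : ∀ K c → O {K} (λ _ _ → c)
  constO K c = weaken K _ (diag 0 (ring (λ _ → c)) (constR c))

  indexO : ∀ K → O {K} (λ _ n → n)
  indexO K = weaken K _ (diag 0 (λ fs → fs zero) (proj 1 zero))

  setAtO : ∀ {K} k c (B : Op K) → O B → O (setAt k c B)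
  setAtO {K} k c B OB = subst-op 2 K _ args (μR k c) argsO
    where
    args : Fin 2 → Op K
    args zero       = λ _ n → n
    args (suc zero) = B
    argsO : ∀ i → O (args i)
    argsO zero       = indexO K
    argsO (suc zero) = OB

  patchO : ∀ {K} c m (B : Op K) → O B → O (patch c m B)
  patchO c zero    B OB = OB
  patchO c (suc m) B OB = patchO c m _ (setAtO m (c m) B OB)

  snocO : ∀ {L} k (Ps : Fin k → Op L) (Q : Op L) → (∀ j → O (Ps j)) → O Q →
          ∀ i → O {L} (λ fb → snoc (λ j → Ps j fb) (Q fb) i)
  snocO zero    Ps Q PsO QO zero    = QO
  snocO (suc k) Ps Q PsO QO zero    = PsO zero
  snocO (suc k) Ps Q PsO QO (suc i) = snocO k (λ j → Ps (suc j)) Q (λ j → PsO (suc j)) QO i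

  freezeO : ∀ {K} c m s (P : Op (suc K)) → O P → O (freeze c m s P)
  freezeO {K} c m s P OP = subst-op (suc K) K P _ OP
    (snocO K _ _ (λ i → patchO (c i) m _ (proj K i)) (constO K s))

canonical-tuple : ∀ N → Point N → Fin (N ℕ.* 3) → 𝕋₁
canonical-tuple N x = interleave N (λ j → canon⁺ (x j)) (λ j → canon⁻ (x j)) (λ j → canonᵈ (x j))

frozen-names : ∀ N (D : Dom N) (θ : RealFun N D) (E : Op (N ℕ.* 3)) (F G H : Op (suc (N ℕ.* 3))) →
  Continuous F → Continuous G → Continuous H →
  ((y : Point N) (dy : D y) (f g h : Fin N → 𝕋₁) → (∀ j → Names (f j) (g j) (h j) (y j)) →
    let fb = interleave N f g h in
    ∀ s → E fb s ≡ 0 → Names (F (snoc fb (ǩ s))) (G (snoc fb (ǩ s))) (H (snoc fb (ǩ s))) (θ y dy)) →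
  (x : Point N) (u s₀ : ℕ) →
  ((gs : Fin (N ℕ.* 3) → 𝕋₁) → (∀ i t → t ℕ.≤ u → gs i t ≡ canonical-tuple N x i t) → E gs s₀ ≡ 0) →
  (y : Point N) (dy : D y) → (∀ j → Distℝ< (y j) (x j) (1/suc (suc (2 ℕ.* u)))) →
  (f g h : Fin N → 𝕋₁) → (∀ j → Names (f j) (g j) (h j) (y j)) →
  let fb = interleave N f g h ; fr = freeze (canonical-tuple N x) (suc u) s₀ in
  Names (fr F fb) (fr G fb) (fr H fb) (θ y dy)
frozen-names N D θ E F G H contF contG contH conditional x u s₀ E-zero y dy near f g h nm =
  names-cong {ξ = θ y dy} (agree F contF) (agree G contG) (agree H contH)
    (conditional y dy f′ g′ h′ names′ s₀ (E-zero fb′ agrees-with-c))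
  where
  m = suc u
  c = canonical-tuple N x
  f′ g′ h′ : Fin N → 𝕋₁
  f′ j = override m (canon⁺ (x j)) (f j)
  g′ j = override m (canon⁻ (x j)) (g j)
  h′ j = override m (canonᵈ (x j)) (h j)
  names′ : ∀ j → Names (f′ j) (g′ j) (h′ j) (y j)
  names′ j = names-override (x j) (y j) u (nm j) (near j)
  fb = interleave N f g h
  fb′ = interleave N f′ g′ h′
  patched : ∀ i t → fb′ i t ≡ override m (c i) (fb i) t
  patched i t = cong (λ φ → φ t) (interleave-pointwise N (override m) _ _ _ f g h i)
  agrees-with-c : ∀ i t → t ℕ.≤ u → fb′ i t ≡ c i t
  agrees-with-c i t t≤u = trans (patched i t) (override-< m (c i) (fb i) (s≤s t≤u))
  agree : ∀ P → Continuous P → ∀ n → P (snoc fb′ (ǩ s₀)) n ≡ freeze c m s₀ P fb n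
  agree P contP = freeze-spec c m s₀ P contP fb fb′ patched

theorem2 : (O : OpClass) → Appropriate O →
    (∀ {k} (F : Op k) → O F → Continuous F) →
    (∀ c → Representable O {1} (λ _ → c)) →
    (∀ k c → Representable O {2} (λ v → μ k c (v zero) (v (suc zero)))) →
    ∀ N (D : Dom N) (θ : RealFun N D) →
    ConditionallyComputable O N D θ → LocallyUniformlyComputable O N D θ
theorem2 O A cont constR μR N D θ (E , F , G , H , OE , OF , OG , OH , spec) x d =
    U , (ε , 1/suc-pos (suc (2 ℕ.* u)) , λ _ Uy → Uy) ,
    (fr F , fr G , fr H , freezeO c m s₀ F OF , freezeO c m s₀ G OG , freezeO c m s₀ H OH ,
     λ y (dy , Uy) → frozen-names N D θ E F G H (cont F OF) (cont G OG) (cont H OH)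
                       (λ y dy f g h nm → proj₂ (spec y dy f g h nm)) x u s₀ E-zero y dy Uy)
  where
  open Closure O A constR μR
  c = canonical-tuple N x
  zero-at-x = proj₁ (spec x d _ _ _ (λ j → canonical-names (x j)))
  s₀ = proj₁ zero-at-x
  u = proj₁ (cont E OE c s₀)
  E-zero : (gs : Fin (N ℕ.* 3) → 𝕋₁) → (∀ i t → t ℕ.≤ u → gs i t ≡ c i t) → E gs s₀ ≡ 0
  E-zero gs agree = trans (proj₂ (cont E OE c s₀) gs agree) (proj₂ zero-at-x)
  m = suc u
  ε = 1/suc (suc (2 ℕ.* u))
  U : Point N → Set
  U y = ∀ j → Distℝ< (y j) (x j) ε
  fr = freeze c m s₀
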